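{- Let $G$ be a finite connected undirected graph with diameter $d$. Consider a candy-passing game on $G$ with $c$ candies in total, where $c \geq 4|E(G)| - |V(G)|$. Then every vertex $v \in V(G)$ stabilizes within $|V(G)| \cdot d \cdot c$ rounds; that is, after round $|V(G)|\cdot d\cdot c$, the number of candies held by each vertex never changes again.
   Context: The candy-passing game on a graph $G$: initially $c>0$ candies are distributed among the vertices of $G$ (each vertex holds a nonnegative integer number of candies). The game proceeds in rounds $t=1,2,\ldots$. In each round, simultaneously, every vertex $v$ that at the beginning of the round holds at least $\deg(v)$ candies passes one candy to each of its neighbors; a vertex holding fewer than $\deg(v)$ candies at the beginning of the round does nothing. A vertex is said to have stabilized in a given round if, after that round, the number of candies it holds never changes for the remainder of the game. -}

module Defs where

open import Data.Nat using (ℕ; zero; suc; _+_; _*_; _∸_; _≤_; _<_; _≤ᵇ_)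
open import Data.Bool using (Bool; true; false; if_then_else_)
open import Data.Fin using (Fin; zero; suc)
open import Data.Product using (Σ; _×_; _,_; ∃)
open import Relation.Binary.PropositionalEquality using (_≡_)
open import Relation.Nullary using (¬_)
open import Function using (_∘_)

record Graph (n : ℕ) : Set where
  field
    adj   : Fin n → Fin n → Bool
    sym   : ∀ u v → adj u v ≡ adj v u
    irrefl : ∀ v → adj v v ≡ false
open Graph public

sumFin : {n : ℕ} → (Fin n → ℕ) → ℕ
sumFin {zero}  f = 0
sumFin {suc n} f = f zero + sumFin (f ∘ suc)

indicator : Bool → ℕ
indicator true  = 1
indicator false = 0

deg : {n : ℕ} → Graph n → Fin n → ℕ
deg G v = sumFin (λ u → indicator (adj G v u))

-- |E(G)| is half the sum of degrees (handshake); we define 2|E(G)| directly.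
twiceEdges : {n : ℕ} → Graph n → ℕ
twiceEdges G = sumFin (deg G)

data Walk {n : ℕ} (G : Graph n) : Fin n → Fin n → ℕ → Set where
  here : ∀ v → Walk G v v 0
  step : ∀ {u w v k} → adj G u w ≡ true → Walk G w v k → Walk G u v (suc k)

Dist : {n : ℕ} → Graph n → Fin n → Fin n → ℕ → Set
Dist G u v k = Walk G u v k × (∀ j → j < k → ¬ Walk G u v j)

Connected : {n : ℕ} → Graph n → Set
Connected G = ∀ u v → ∃ λ k → Walk G u v k

HasDiameter : {n : ℕ} → Graph n → ℕ → Set
HasDiameter G d =
  (∀ u v → ∃ λ k → k ≤ d × Dist G u v k) ×
  (Σ _ λ u → Σ _ λ v → Dist G u v d)

Config : ℕ → Set
Config n = Fin n → ℕ

fires : {n : ℕ} → Graph n → Config n → Fin n → Bool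
fires G x v = deg G v ≤ᵇ x v

stepGame : {n : ℕ} → Graph n → Config n → Config n
stepGame G x v =
  (if fires G x v then x v ∸ deg G v else x v)
  + sumFin (λ u → if adj G u v then indicator (fires G x u) else 0)

play : {n : ℕ} → Graph n → Config n → ℕ → Config n
play G x zero    = x
play G x (suc t) = stepGame G (play G x t)

module Submission where

-- Let D t v count the rounds before t in which v was idle (did not fire).  After t rounds
-- the configuration is x + L (D t), with L the Laplacian of G.  Summing this identity over
-- the upper set {w | D t w ≥ D t u} shows that along any edge D t drops by at most c: the
-- net flow out of that set is paid for by the candies inside it.  A vertex holding at
-- least 2 deg v candies has always done so (a poorer vertex never reaches that level), so
-- it was never idle; if such a vertex exists at T = n d c, then Σ_v D T v < T and some
-- round before T had every vertex firing.  If none exists, c ≥ 4|E| − n forces every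
-- vertex to hold exactly 2 deg v − 1 ≥ deg v candies, so again every vertex fires.
-- A configuration in which every vertex fires is a fixed point of the game.

open import Defs hiding (sym)
open import Data.Nat using (ℕ; zero; suc; _+_; _*_; _∸_; _≤_; _<_; _≤ᵇ_; z≤n; _≤?_; _≟_)
open import Data.Nat.Properties
open import Algebra.Properties.CommutativeSemigroup +-commutativeSemigroup
  using (interchange; x∙yz≈xz∙y; xy∙z≈xz∙y; x∙yz≈y∙xz)
open import Algebra.Properties.Semiring.Sum +-*-semiring using (sum; ∑-comm)
open import Data.Bool using (Bool; true; false; if_then_else_; not; T)
open import Data.Fin using (Fin; zero; suc)
open import Data.Fin.Properties using (any?)
open import Data.Product using (_×_; _,_; ∃-syntax)
open import Data.Sum using (_⊎_; inj₁; inj₂)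
open import Function using (_∘_; flip)
open import Relation.Nullary using (¬_; yes; no; contradiction)
open import Relation.Nullary.Reflects using (Reflects; ofʸ; ofⁿ)
open import Relation.Binary.PropositionalEquality
  using (_≡_; refl; sym; trans; cong; cong₂; subst; subst₂; module ≡-Reasoning)

sumFin-cong : ∀ {n} {f g : Fin n → ℕ} → (∀ i → f i ≡ g i) → sumFin f ≡ sumFin g
sumFin-cong {zero}  f≗g = refl
sumFin-cong {suc n} f≗g = cong₂ _+_ (f≗g zero) (sumFin-cong (f≗g ∘ suc))

sumFin-+ : ∀ {n} (f g : Fin n → ℕ) → sumFin (λ i → f i + g i) ≡ sumFin f + sumFin g
sumFin-+ {zero}  f g = refl
sumFin-+ {suc n} f g = trans (cong (f zero + g zero +_) (sumFin-+ (f ∘ suc) (g ∘ suc)))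
                             (interchange (f zero) (g zero) (sumFin (f ∘ suc)) (sumFin (g ∘ suc)))

sumFin-const : ∀ {n} k → sumFin {n} (λ _ → k) ≡ n * k
sumFin-const {zero}  k = refl
sumFin-const {suc n} k = cong (k +_) (sumFin-const {n} k)

sumFin-*ʳ : ∀ {n} (f : Fin n → ℕ) k → sumFin f * k ≡ sumFin (λ i → f i * k)
sumFin-*ʳ {zero}  f k = refl
sumFin-*ʳ {suc n} f k = trans (*-distribʳ-+ k (f zero) (sumFin (f ∘ suc)))
                              (cong (f zero * k +_) (sumFin-*ʳ (f ∘ suc) k))

sumFin-mono : ∀ {n} {f g : Fin n → ℕ} → (∀ i → f i ≤ g i) → sumFin f ≤ sumFin g
sumFin-mono {zero}  f≤g = z≤n
sumFin-mono {suc n} f≤g = +-mono-≤ (f≤g zero) (sumFin-mono (f≤g ∘ suc))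

sumFin-mono-+ : ∀ {n} {f g : Fin n → ℕ} {k} → (∀ i → f i ≤ g i) →
                ∀ j → f j + k ≤ g j → sumFin f + k ≤ sumFin g
sumFin-mono-+ {suc n} {f} {g} {k} f≤g zero fj+k≤gj = begin
  f zero + sumFin (f ∘ suc) + k  ≡⟨ xy∙z≈xz∙y (f zero) _ k ⟩
  f zero + k + sumFin (f ∘ suc)  ≤⟨ +-mono-≤ fj+k≤gj (sumFin-mono (f≤g ∘ suc)) ⟩
  g zero + sumFin (g ∘ suc)      ∎
  where open ≤-Reasoning
sumFin-mono-+ {suc n} {f} {g} {k} f≤g (suc j) fj+k≤gj = begin
  f zero + sumFin (f ∘ suc) + k    ≡⟨ +-assoc (f zero) _ k ⟩
  f zero + (sumFin (f ∘ suc) + k)  ≤⟨ +-mono-≤ (f≤g zero) (sumFin-mono-+ (f≤g ∘ suc) j fj+k≤gj) ⟩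
  g zero + sumFin (g ∘ suc)        ∎
  where open ≤-Reasoning

sumFin-tight : ∀ {n} {f g : Fin n → ℕ} → (∀ i → f i ≤ g i) → sumFin g ≤ sumFin f →
               ∀ i → f i ≡ g i
sumFin-tight {suc n} {f} {g} f≤g Σg≤Σf = λ where
    zero    → ≤-antisym (f≤g zero) g₀≤f₀
    (suc i) → sumFin-tight (f≤g ∘ suc) (+-cancelˡ-≤ (g zero) _ _ tail≤) i
  where
  g₀≤f₀ : g zero ≤ f zero
  g₀≤f₀ = +-cancelʳ-≤ (sumFin (g ∘ suc)) _ _
            (≤-trans Σg≤Σf (+-monoʳ-≤ (f zero) (sumFin-mono (f≤g ∘ suc))))
  tail≤ : g zero + sumFin (g ∘ suc) ≤ g zero + sumFin (f ∘ suc)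
  tail≤ = ≤-trans Σg≤Σf (+-monoˡ-≤ (sumFin (f ∘ suc)) (f≤g zero))

sumFin-≡0 : ∀ {n} (f : Fin n → ℕ) → sumFin f ≡ 0 → ∀ i → f i ≡ 0
sumFin-≡0 {suc n} f Σf≡0 zero    = m+n≡0⇒m≡0 (f zero) Σf≡0
sumFin-≡0 {suc n} f Σf≡0 (suc i) = sumFin-≡0 (f ∘ suc) (m+n≡0⇒n≡0 (f zero) Σf≡0) i

sumFin≡sum : ∀ {n} (f : Fin n → ℕ) → sumFin f ≡ sum f
sumFin≡sum {zero}  f = refl
sumFin≡sum {suc n} f = cong (f zero +_) (sumFin≡sum (f ∘ suc))

sumFin-comm : ∀ {m n} (F : Fin m → Fin n → ℕ) →
              sumFin (λ i → sumFin (F i)) ≡ sumFin (λ j → sumFin (λ i → F i j))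
sumFin-comm F = trans (double F) (trans (∑-comm F) (sym (double (flip F))))
  where
  double : ∀ {m n} (F : Fin m → Fin n → ℕ) → sumFin (λ i → sumFin (F i)) ≡ sum (λ i → sum (F i))
  double F = trans (sumFin-cong (sumFin≡sum ∘ F)) (sumFin≡sum (λ i → sum (F i)))

when : Bool → ℕ → ℕ
when b k = if b then k else 0

when-+ : ∀ b p q → when b (p + q) ≡ when b p + when b q
when-+ true  p q = refl
when-+ false p q = refl

when-sumFin : ∀ {n} b (f : Fin n → ℕ) → when b (sumFin f) ≡ sumFin (λ i → when b (f i))
when-sumFin     true  f = refl
when-sumFin {n} false f = sym (trans (sumFin-const {n} 0) (*-zeroʳ n))

when-split : ∀ b k → when b k + when (not b) k ≡ k
when-split true  k = +-identityʳ k
when-split false k = refl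

when-comm : ∀ a b k → when a (when b k) ≡ when b (when a k)
when-comm true  true  k = refl
when-comm true  false k = refl
when-comm false true  k = refl
when-comm false false k = refl

when-≤ : ∀ b k → when b k ≤ k
when-≤ true  k = ≤-refl
when-≤ false k = z≤n

when-monoᵀ : ∀ b {p q} → (T b → p ≤ q) → when b p ≤ when b q
when-monoᵀ true  p≤q = p≤q _
when-monoᵀ false p≤q = z≤n

when-T : ∀ {b} k → T b → when b k ≡ k
when-T {true} k _ = refl

indicator-* : ∀ b k → indicator b * k ≡ when b k
indicator-* true  k = +-identityʳ k
indicator-* false k = refl

indicator-not : ∀ b → indicator b + indicator (not b) ≡ 1
indicator-not true  = refl
indicator-not false = refl

indicator-not≡0⇒T : ∀ {b} → indicator (not b) ≡ 0 → T b
indicator-not≡0⇒T {true} _ = _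

T⇒indicator-not≡0 : ∀ {b} → T b → indicator (not b) ≡ 0
T⇒indicator-not≡0 {true} _ = refl

T-not-≤ᵇ⇒> : ∀ m n → T (not (m ≤ᵇ n)) → n < m
T-not-≤ᵇ⇒> m n t with m ≤ᵇ n | ≤ᵇ-reflects-≤ m n
... | false | ofⁿ m≰n = ≰⇒> m≰n

≰⇒T-not-≤ᵇ : ∀ {m n} → ¬ (m ≤ n) → T (not (m ≤ᵇ n))
≰⇒T-not-≤ᵇ {m} {n} m≰n with m ≤ᵇ n | ≤ᵇ-reflects-≤ m n
... | true  | ofʸ m≤n = contradiction m≤n m≰n
... | false | _       = _

1+m≡n+n⇒n≤m : ∀ {m n} → suc m ≡ n + n → n ≤ m
1+m≡n+n⇒n≤m {n = suc n} e = subst (suc n ≤_) (sym (suc-injective e)) (m≤n+m (suc n) n)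

-- One vertex of stepGame: y candies, degree d, firing (b) iff d ≤ y; it receives r candies,
-- and q is what its idle neighbours withhold.
fire-balance : ∀ {b y d r q} → Reflects (d ≤ y) b → r + q ≡ d →
               (if b then y ∸ d else y) + r + q ≡ y + d * indicator (not b)
fire-balance {y = y} {d} {r} {q} (ofʸ d≤y) r+q≡d = begin
  y ∸ d + r + q    ≡⟨ +-assoc (y ∸ d) r q ⟩
  y ∸ d + (r + q)  ≡⟨ cong (y ∸ d +_) r+q≡d ⟩
  y ∸ d + d        ≡⟨ m∸n+n≡m d≤y ⟩
  y                ≡⟨ sym (+-identityʳ y) ⟩
  y + 0            ≡⟨ cong (y +_) (sym (*-zeroʳ d)) ⟩
  y + d * 0        ∎
  where open ≡-Reasoning
fire-balance {y = y} {d} {r} {q} (ofⁿ _) r+q≡d = begin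
  y + r + q    ≡⟨ +-assoc y r q ⟩
  y + (r + q)  ≡⟨ cong (y +_) (trans r+q≡d (sym (*-identityʳ d))) ⟩
  y + d * 1    ∎
  where open ≡-Reasoning

fire-poor : ∀ {b y d r} → Reflects (d ≤ y) b → r ≤ d → y < d + d →
            (if b then y ∸ d else y) + r < d + d
fire-poor {y = y} {d} {r} (ofʸ d≤y) r≤d y<2d = begin-strict
  y ∸ d + r  ≤⟨ +-monoʳ-≤ (y ∸ d) r≤d ⟩
  y ∸ d + d  ≡⟨ m∸n+n≡m d≤y ⟩
  y          <⟨ y<2d ⟩
  d + d      ∎
  where open ≤-Reasoning
fire-poor (ofⁿ d≰y) r≤d _ = +-mono-<-≤ (≰⇒> d≰y) r≤d

module Game {n : ℕ} (G : Graph n) where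

  nbrSum : (Fin n → ℕ) → Fin n → ℕ
  nbrSum h u = sumFin (λ w → when (adj G w u) (h w))

  nbrSum-cong : ∀ {f g} → (∀ w → f w ≡ g w) → ∀ u → nbrSum f u ≡ nbrSum g u
  nbrSum-cong f≗g u = sumFin-cong (λ w → cong (when (adj G w u)) (f≗g w))

  nbrSum-+ : ∀ f g u → nbrSum (λ w → f w + g w) u ≡ nbrSum f u + nbrSum g u
  nbrSum-+ f g u = trans (sumFin-cong (λ w → when-+ (adj G w u) (f w) (g w)))
                         (sumFin-+ (λ w → when (adj G w u) (f w)) (λ w → when (adj G w u) (g w)))

  deg-* : ∀ u k → deg G u * k ≡ sumFin (λ w → when (adj G w u) k)
  deg-* u k = trans (sumFin-*ʳ (indicator ∘ adj G u) k) (sumFin-cong incident)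
    where
    incident : ∀ w → indicator (adj G u w) * k ≡ when (adj G w u) k
    incident w = trans (indicator-* (adj G u w) k) (cong (λ b → when b k) (Graph.sym G u w))

  pairSum : (Fin n → Bool) → (Fin n → Bool) → (Fin n → Fin n → ℕ) → ℕ
  pairSum A B F = sumFin λ u → sumFin λ w → when (A u) (when (B w) (when (adj G w u) (F u w)))

  pairSum-split : ∀ A B F →
    sumFin (λ u → when (A u) (sumFin λ w → when (adj G w u) (F u w))) ≡
    pairSum A B F + pairSum A (not ∘ B) F
  pairSum-split A B F = begin
    sumFin (λ u → when (A u) (sumFin λ w → E u w))
      ≡⟨ sumFin-cong (λ u → when-sumFin (A u) (E u)) ⟩
    sumFin (λ u → sumFin λ w → when (A u) (E u w))
      ≡⟨ sumFin-cong (λ u → trans (sumFin-cong (split u)) (sumFin-+ (inside u) (outside u))) ⟩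
    sumFin (λ u → sumFin (inside u) + sumFin (outside u))
      ≡⟨ sumFin-+ (sumFin ∘ inside) (sumFin ∘ outside) ⟩
    pairSum A B F + pairSum A (not ∘ B) F
      ∎
    where
    open ≡-Reasoning
    E inside outside : Fin n → Fin n → ℕ
    E u w       = when (adj G w u) (F u w)
    inside u w  = when (A u) (when (B w) (E u w))
    outside u w = when (A u) (when (not (B w)) (E u w))
    split : ∀ u w → when (A u) (E u w) ≡ inside u w + outside u w
    split u w = trans (cong (when (A u)) (sym (when-split (B w) (E u w))))
                      (when-+ (A u) (when (B w) (E u w)) (when (not (B w)) (E u w)))

  pairSum-flip : ∀ A B F → pairSum A B F ≡ pairSum B A (flip F)
  pairSum-flip A B F = trans (sumFin-comm summand) (sumFin-cong λ w → sumFin-cong λ u → swap u w)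
    where
    summand : Fin n → Fin n → ℕ
    summand u w = when (A u) (when (B w) (when (adj G w u) (F u w)))
    swap : ∀ u w → summand u w ≡ when (B w) (when (A u) (when (adj G u w) (F u w)))
    swap u w = trans (when-comm (A u) (B w) _)
                     (cong (λ b → when (B w) (when (A u) (when b (F u w)))) (Graph.sym G w u))

  sumOver : (Fin n → Bool) → (Fin n → ℕ) → ℕ
  sumOver S y = sumFin (λ u → when (S u) (y u))

  sumOver-+ : ∀ S f g → sumOver S (λ u → f u + g u) ≡ sumOver S f + sumOver S g
  sumOver-+ S f g = trans (sumFin-cong (λ u → when-+ (S u) (f u) (g u)))
                          (sumFin-+ (λ u → when (S u) (f u)) (λ u → when (S u) (g u)))

  -- y = x + L h for the Laplacian L of G, written without subtraction.
  ShiftedBy : (Fin n → ℕ) → Config n → Config n → Set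
  ShiftedBy h x y = ∀ u → y u + nbrSum h u ≡ x u + deg G u * h u

  shiftedBy-zero : ∀ x → ShiftedBy (λ _ → 0) x x
  shiftedBy-zero x u = cong (x u +_) (sym (deg-* u 0))

  shiftedBy-trans : ∀ {h h′ x y z} → ShiftedBy h x y → ShiftedBy h′ y z →
                    ShiftedBy (λ u → h u + h′ u) x z
  shiftedBy-trans {h} {h′} {x} {y} {z} x→y y→z u = begin
    z u + nbrSum (λ w → h w + h′ w) u       ≡⟨ cong (z u +_) (nbrSum-+ h h′ u) ⟩
    z u + (nbrSum h u + nbrSum h′ u)        ≡⟨ x∙yz≈xz∙y (z u) _ _ ⟩
    z u + nbrSum h′ u + nbrSum h u          ≡⟨ cong (_+ nbrSum h u) (y→z u) ⟩
    y u + deg G u * h′ u + nbrSum h u       ≡⟨ xy∙z≈xz∙y (y u) _ _ ⟩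
    y u + nbrSum h u + deg G u * h′ u       ≡⟨ cong (_+ deg G u * h′ u) (x→y u) ⟩
    x u + deg G u * h u + deg G u * h′ u    ≡⟨ +-assoc (x u) _ _ ⟩
    x u + (deg G u * h u + deg G u * h′ u)  ≡⟨ cong (x u +_) (sym (*-distribˡ-+ (deg G u) (h u) (h′ u))) ⟩
    x u + deg G u * (h u + h′ u)            ∎
    where open ≡-Reasoning

  -- Summing the defining identity over S, the terms for edges inside S cancel; only the
  -- edges leaving S remain, weighted by h at the outer resp. the inner endpoint.
  cut-balance : ∀ {h x y} → ShiftedBy h x y → ∀ S →
    sumOver S y + pairSum S (not ∘ S) (λ _ w → h w) ≡ sumOver S x + pairSum S (not ∘ S) (λ u _ → h u)
  cut-balance {h} {x} {y} x→y S = +-cancelˡ-≡ (pairSum S S hᵤ) _ _ (begin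
    pairSum S S hᵤ + (sumOver S y + out hᵥ)
      ≡⟨ cong (_+ (sumOver S y + out hᵥ)) (sym (pairSum-flip S S hᵥ)) ⟩
    pairSum S S hᵥ + (sumOver S y + out hᵥ)
      ≡⟨ x∙yz≈y∙xz (pairSum S S hᵥ) (sumOver S y) (out hᵥ) ⟩
    sumOver S y + (pairSum S S hᵥ + out hᵥ)
      ≡⟨ cong (sumOver S y +_) (sym (pairSum-split S S hᵥ)) ⟩
    sumOver S y + sumOver S (nbrSum h)
      ≡⟨ sym (sumOver-+ S y (nbrSum h)) ⟩
    sumOver S (λ u → y u + nbrSum h u)
      ≡⟨ sumFin-cong (λ u → cong (when (S u)) (x→y u)) ⟩
    sumOver S (λ u → x u + deg G u * h u)
      ≡⟨ sumOver-+ S x _ ⟩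
    sumOver S x + sumOver S (λ u → deg G u * h u)
      ≡⟨ cong (sumOver S x +_) inner ⟩
    sumOver S x + (pairSum S S hᵤ + out hᵤ)
      ≡⟨ x∙yz≈y∙xz (sumOver S x) (pairSum S S hᵤ) (out hᵤ) ⟩
    pairSum S S hᵤ + (sumOver S x + out hᵤ)
      ∎)
    where
    open ≡-Reasoning
    hᵥ hᵤ : Fin n → Fin n → ℕ
    hᵥ _ w = h w
    hᵤ u _ = h u
    out : (Fin n → Fin n → ℕ) → ℕ
    out = pairSum S (not ∘ S)
    inner : sumOver S (λ u → deg G u * h u) ≡ pairSum S S hᵤ + out hᵤ
    inner = trans (sumFin-cong (λ u → cong (when (S u)) (deg-* u (h u)))) (pairSum-split S S hᵤ)

  shiftedBy-sum : ∀ {h x y} → ShiftedBy h x y → sumFin y ≡ sumFin x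
  shiftedBy-sum x→y = +-cancelʳ-≡ _ _ _ (cut-balance x→y (λ _ → true))

  pairSum-mono-+ : ∀ A B {F F′} → (∀ u w → T (A u) → T (B w) → F u w ≤ F′ u w) →
    ∀ {u₀ w₀ k} → T (A u₀) → T (B w₀) → adj G w₀ u₀ ≡ true → F u₀ w₀ + k ≤ F′ u₀ w₀ →
    pairSum A B F + k ≤ pairSum A B F′
  pairSum-mono-+ A B {F} {F′} F≤F′ {u₀} {w₀} {k} a b e gap =
    sumFin-mono-+ (λ u → sumFin-mono (term≤ u)) u₀ (sumFin-mono-+ (term≤ u₀) w₀ edge-gap)
    where
    term : (Fin n → Fin n → ℕ) → Fin n → Fin n → ℕ
    term F u w = when (A u) (when (B w) (when (adj G w u) (F u w)))
    term≤ : ∀ u w → term F u w ≤ term F′ u w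
    term≤ u w = when-monoᵀ (A u) λ a → when-monoᵀ (B w) λ b →
                when-monoᵀ (adj G w u) λ _ → F≤F′ u w a b
    selected : ∀ F → term F u₀ w₀ ≡ F u₀ w₀
    selected F = trans (when-T {A u₀} _ a)
                (trans (when-T {B w₀} _ b) (cong (λ c → when c (F u₀ w₀)) e))
    edge-gap : term F u₀ w₀ + k ≤ term F′ u₀ w₀
    edge-gap = subst₂ (λ p q → p + k ≤ q) (sym (selected F)) (sym (selected F′)) gap

  -- Apply cut-balance to the upper set S = {v | h u ≤ h v}: every edge leaving S runs
  -- downhill, and the edge u–w alone contributes the gap h u ∸ h w.
  gap-bound : ∀ {h x y} → ShiftedBy h x y → ∀ {u w} → adj G u w ≡ true → h u ∸ h w ≤ sumFin y
  gap-bound {h} {x} {y} x→y {u} {w} u~w with h u ≤? h w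
  ... | yes hu≤hw = subst (_≤ sumFin y) (sym (m≤n⇒m∸n≡0 hu≤hw)) z≤n
  ... | no  hu≰hw = begin
    h u ∸ h w    ≤⟨ +-cancelˡ-≤ (pairSum S (not ∘ S) hᵥ) _ _ crossing ⟩
    sumOver S y  ≤⟨ sumFin-mono (λ v → when-≤ (S v) (y v)) ⟩
    sumFin y     ∎
    where
    open ≤-Reasoning
    S : Fin n → Bool
    S v = h u ≤ᵇ h v
    hᵥ hᵤ : Fin n → Fin n → ℕ
    hᵥ _ v = h v
    hᵤ v _ = h v
    downhill : ∀ v t → T (S v) → T (not (S t)) → h t ≤ h v
    downhill v t v∈S t∉S = ≤-trans (<⇒≤ (T-not-≤ᵇ⇒> (h u) (h t) t∉S)) (≤ᵇ⇒≤ (h u) (h v) v∈S)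
    gap : h w + (h u ∸ h w) ≤ h u
    gap = ≤-reflexive (m+[n∸m]≡n (<⇒≤ (≰⇒> hu≰hw)))
    crossing : pairSum S (not ∘ S) hᵥ + (h u ∸ h w) ≤ pairSum S (not ∘ S) hᵥ + sumOver S y
    crossing = begin
      pairSum S (not ∘ S) hᵥ + (h u ∸ h w)
        ≤⟨ pairSum-mono-+ S (not ∘ S) downhill (≤⇒≤ᵇ (≤-refl {h u})) (≰⇒T-not-≤ᵇ hu≰hw)
                          (trans (Graph.sym G w u) u~w) gap ⟩
      pairSum S (not ∘ S) hᵤ
        ≤⟨ m≤n+m _ (sumOver S x) ⟩
      sumOver S x + pairSum S (not ∘ S) hᵤ
        ≡⟨ sym (cut-balance x→y S) ⟩
      sumOver S y + pairSum S (not ∘ S) hᵥ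
        ≡⟨ +-comm (sumOver S y) _ ⟩
      pairSum S (not ∘ S) hᵥ + sumOver S y
        ∎

  walk-bound : ∀ {h x y} → ShiftedBy h x y → ∀ {u r k} → Walk G u r k → h u ≤ h r + k * sumFin y
  walk-bound {h} x→y (here v) = m≤m+n (h v) 0
  walk-bound {h} {y = y} x→y (step {u} {w} {r} {k} u~w w⇝r) = begin
    h u                               ≤⟨ m≤n+m∸n (h u) (h w) ⟩
    h w + (h u ∸ h w)                 ≤⟨ +-mono-≤ (walk-bound x→y w⇝r) (gap-bound x→y u~w) ⟩
    h r + k * sumFin y + sumFin y     ≡⟨ +-assoc (h r) _ _ ⟩
    h r + (k * sumFin y + sumFin y)   ≡⟨ cong (h r +_) (+-comm (k * sumFin y) _) ⟩
    h r + suc k * sumFin y            ∎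
    where open ≤-Reasoning

  active idle : Config n → Fin n → ℕ
  active y v = indicator (fires G y v)
  idle   y v = indicator (not (fires G y v))

  AllFire : Config n → Set
  AllFire y = ∀ v → T (fires G y v)

  Rich : Config n → Fin n → Set
  Rich y v = deg G v + deg G v ≤ y v

  fires-reflects : ∀ y v → Reflects (deg G v ≤ y v) (fires G y v)
  fires-reflects y v = ≤ᵇ-reflects-≤ (deg G v) (y v)

  active+idle : ∀ y v → nbrSum (active y) v + nbrSum (idle y) v ≡ deg G v
  active+idle y v = begin
    nbrSum (active y) v + nbrSum (idle y) v  ≡⟨ sym (nbrSum-+ (active y) (idle y) v) ⟩
    nbrSum (λ w → active y w + idle y w) v   ≡⟨ nbrSum-cong (λ w → indicator-not (fires G y w)) v ⟩
    nbrSum (λ _ → 1) v                       ≡⟨ sym (deg-* v 1) ⟩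
    deg G v * 1                              ≡⟨ *-identityʳ (deg G v) ⟩
    deg G v                                  ∎
    where open ≡-Reasoning

  stepGame-shifted : ∀ y → ShiftedBy (idle y) y (stepGame G y)
  stepGame-shifted y v = fire-balance (fires-reflects y v) (active+idle y v)

  stepGame-poor : ∀ y v → y v < deg G v + deg G v → stepGame G y v < deg G v + deg G v
  stepGame-poor y v = fire-poor (fires-reflects y v) (m+n≤o⇒m≤o _ (≤-reflexive (active+idle y v)))

  stepGame-rich⇒rich : ∀ y v → Rich (stepGame G y) v → Rich y v
  stepGame-rich⇒rich y v rich with deg G v + deg G v ≤? y v
  ... | yes rich′ = rich′
  ... | no  poor  = contradiction rich (<⇒≱ (stepGame-poor y v (≰⇒> poor)))

  stepGame-allFire : ∀ {y} → AllFire y → ∀ v → stepGame G y v ≡ y v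
  stepGame-allFire {y} all v = +-cancelʳ-≡ (deg G v * 0) _ _ (begin
    stepGame G y v + deg G v * 0        ≡⟨ cong (stepGame G y v +_) (deg-* v 0) ⟩
    stepGame G y v + nbrSum (λ _ → 0) v ≡⟨ cong (stepGame G y v +_) (nbrSum-cong (λ w → sym (none-idle w)) v) ⟩
    stepGame G y v + nbrSum (idle y) v  ≡⟨ stepGame-shifted y v ⟩
    y v + deg G v * idle y v            ≡⟨ cong (λ i → y v + deg G v * i) (none-idle v) ⟩
    y v + deg G v * 0                   ∎)
    where
    open ≡-Reasoning
    none-idle : ∀ w → idle y w ≡ 0
    none-idle w = T⇒indicator-not≡0 (all w)

  stepGame-cong : ∀ {y z} → (∀ v → y v ≡ z v) → ∀ v → stepGame G y v ≡ stepGame G z v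
  stepGame-cong y≗z v =
    cong₂ _+_ (cong (λ m → if deg G v ≤ᵇ m then m ∸ deg G v else m) (y≗z v))
              (sumFin-cong λ u → cong (λ m → when (adj G u v) (indicator (deg G u ≤ᵇ m))) (y≗z u))

  play-allFire : ∀ {y} → AllFire y → ∀ t v → play G y t v ≡ y v
  play-allFire all zero    v = refl
  play-allFire all (suc t) v = trans (stepGame-cong (play-allFire all t) v) (stepGame-allFire all v)

  play-+ : ∀ x j k → play G x (j + k) ≡ play G (play G x k) j
  play-+ x zero    k = refl
  play-+ x (suc j) k = cong (stepGame G) (play-+ x j k)

  -- Σ (y v + 1) ≤ Σ 2 deg v = 4|E| ≤ Σ y + n forces y v = 2 deg v − 1 ≥ deg v everywhere.
  allPoor⇒allFire : ∀ y → (∀ v → y v < deg G v + deg G v) → 2 * twiceEdges G ≤ sumFin y + n → AllFire y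
  allPoor⇒allFire y poor dense v = ≤⇒≤ᵇ (1+m≡n+n⇒n≤m {y v} {deg G v} (sumFin-tight poor total v))
    where
    open ≤-Reasoning
    total : sumFin (λ v → deg G v + deg G v) ≤ sumFin (λ v → suc (y v))
    total = begin
      sumFin (λ v → deg G v + deg G v)  ≡⟨ sumFin-+ (deg G) (deg G) ⟩
      twiceEdges G + twiceEdges G       ≡⟨ cong (twiceEdges G +_) (sym (+-identityʳ (twiceEdges G))) ⟩
      2 * twiceEdges G                  ≤⟨ dense ⟩
      sumFin y + n                      ≡⟨ +-comm (sumFin y) n ⟩
      n + sumFin y                      ≡⟨ cong (_+ sumFin y) (sym (trans (sumFin-const {n} 1) (*-identityʳ n))) ⟩
      sumFin {n} (λ _ → 1) + sumFin y   ≡⟨ sym (sumFin-+ (λ _ → 1) y) ⟩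
      sumFin (λ v → suc (y v))          ∎

  DiameterAtMost : ℕ → Set
  DiameterAtMost d = ∀ u v → ∃[ k ] k ≤ d × Walk G u v k

  diameterAtMost-zero⇒deg≡0 : DiameterAtMost 0 → ∀ v → deg G v ≡ 0
  diameterAtMost-zero⇒deg≡0 diam v = trans (sumFin-cong no-edge) (trans (sumFin-const {n} 0) (*-zeroʳ n))
    where
    no-edge : ∀ u → indicator (adj G v u) ≡ 0
    no-edge u with adj G v u in v~u | diam v u
    ... | false | _ = refl
    ... | true  | _ , z≤n , here _ = contradiction (trans (sym v~u) (Graph.irrefl G v)) λ ()

  module _ (x : Config n) where

    idleCount : ℕ → Fin n → ℕ
    idleCount zero    v = 0
    idleCount (suc t) v = idleCount t v + idle (play G x t) v

    play-shifted : ∀ t → ShiftedBy (idleCount t) x (play G x t)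
    play-shifted zero    = shiftedBy-zero x
    play-shifted (suc t) = shiftedBy-trans (play-shifted t) (stepGame-shifted (play G x t))

    play-sum : ∀ t → sumFin (play G x t) ≡ sumFin x
    play-sum t = shiftedBy-sum (play-shifted t)

    rich⇒idleCount≡0 : ∀ t r → Rich (play G x t) r → idleCount t r ≡ 0
    rich⇒idleCount≡0 zero    r rich = refl
    rich⇒idleCount≡0 (suc t) r rich =
      cong₂ _+_ (rich⇒idleCount≡0 t r rich′) (T⇒indicator-not≡0 (≤⇒≤ᵇ (m+n≤o⇒m≤o (deg G r) rich′)))
      where
      rich′ : Rich (play G x t) r
      rich′ = stepGame-rich⇒rich (play G x t) r rich

    allFire-or-idleCount : ∀ t → (∃[ k ] k < t × AllFire (play G x k)) ⊎ t ≤ sumFin (idleCount t)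
    allFire-or-idleCount zero = inj₂ z≤n
    allFire-or-idleCount (suc t) with allFire-or-idleCount t | sumFin (idle (play G x t)) ≟ 0
    ... | inj₁ (k , k<t , all) | _    = inj₁ (k , m<n⇒m<1+n k<t , all)
    ... | inj₂ _               | yes none-idle =
      inj₁ (t , ≤-refl , λ v → indicator-not≡0⇒T (sumFin-≡0 (idle (play G x t)) none-idle v))
    ... | inj₂ t≤Σ             | no  some-idle = inj₂ (begin
      suc t                                                ≡⟨ +-comm 1 t ⟩
      t + 1                                                ≤⟨ +-mono-≤ t≤Σ (n≢0⇒n>0 some-idle) ⟩
      sumFin (idleCount t) + sumFin (idle (play G x t))    ≡⟨ sym (sumFin-+ (idleCount t) (idle (play G x t))) ⟩
      sumFin (idleCount (suc t))                           ∎)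
      where open ≤-Reasoning

    rich⇒idleCount-bound : ∀ {d} → DiameterAtMost d → ∀ t r → Rich (play G x t) r →
                           sumFin (idleCount t) + d * sumFin x ≤ n * (d * sumFin x)
    rich⇒idleCount-bound {d} diam t r rich = begin
      sumFin (idleCount t) + d * sumFin x  ≤⟨ sumFin-mono-+ bound r at-r ⟩
      sumFin {n} (λ _ → d * sumFin x)      ≡⟨ sumFin-const {n} (d * sumFin x) ⟩
      n * (d * sumFin x)                   ∎
      where
      open ≤-Reasoning
      never-idle : idleCount t r ≡ 0
      never-idle = rich⇒idleCount≡0 t r rich
      bound : ∀ v → idleCount t v ≤ d * sumFin x
      bound v with diam v r
      ... | k , k≤d , v⇝r = begin
        idleCount t v                                  ≤⟨ walk-bound (play-shifted t) v⇝r ⟩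
        idleCount t r + k * sumFin (play G x t)        ≡⟨ cong₂ (λ i s → i + k * s) never-idle (play-sum t) ⟩
        k * sumFin x                                   ≤⟨ *-monoˡ-≤ (sumFin x) k≤d ⟩
        d * sumFin x                                   ∎
      at-r : idleCount t r + d * sumFin x ≤ d * sumFin x
      at-r = ≤-reflexive (cong (_+ d * sumFin x) never-idle)

    rich⇒allFire-before : ∀ {d} → DiameterAtMost d → 0 < d * sumFin x →
                          ∀ {r} → Rich (play G x (n * d * sumFin x)) r →
                          ∃[ k ] k < n * d * sumFin x × AllFire (play G x k)
    rich⇒allFire-before {d} diam dc>0 {r} rich with allFire-or-idleCount (n * d * sumFin x)
    ... | inj₁ early = early
    ... | inj₂ T≤idled = contradiction (+-cancelˡ-≤ idled (d * sumFin x) 0 too-many) (<⇒≱ dc>0)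
      where
      open ≤-Reasoning
      idled : ℕ
      idled = sumFin (idleCount (n * d * sumFin x))
      too-many : idled + d * sumFin x ≤ idled + 0
      too-many = begin
        idled + d * sumFin x  ≤⟨ rich⇒idleCount-bound diam (n * d * sumFin x) r rich ⟩
        n * (d * sumFin x)    ≡⟨ sym (*-assoc n d (sumFin x)) ⟩
        n * d * sumFin x      ≤⟨ T≤idled ⟩
        idled                 ≡⟨ sym (+-identityʳ idled) ⟩
        idled + 0             ∎

    allFire-within : ∀ d → DiameterAtMost d → 0 < sumFin x → 2 * twiceEdges G ≤ sumFin x + n →
                     ∃[ k ] k ≤ n * d * sumFin x × AllFire (play G x k)
    allFire-within zero diam _ _ =
      0 , z≤n , λ v → ≤⇒≤ᵇ (subst (_≤ x v) (sym (diameterAtMost-zero⇒deg≡0 diam v)) z≤n)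
    allFire-within d@(suc d′) diam c>0 dense
      with any? (λ r → deg G r + deg G r ≤? play G x (n * d * sumFin x) r)
    ... | yes (r , rich) =
      let k , k<T , all = rich⇒allFire-before diam (≤-trans c>0 (m≤m+n (sumFin x) (d′ * sumFin x))) rich
      in k , <⇒≤ k<T , all
    ... | no none-rich =
      n * d * sumFin x , ≤-refl ,
      allPoor⇒allFire (play G x (n * d * sumFin x))
        (λ v → ≰⇒> (λ rich → none-rich (v , rich)))
        (subst (λ c → 2 * twiceEdges G ≤ c + n) (sym (play-sum (n * d * sumFin x))) dense)

    play-stable : ∀ {k t} → AllFire (play G x k) → k ≤ t → ∀ v → play G x t v ≡ play G x k v
    play-stable {k} {t} all k≤t v = begin
      play G x t v                   ≡⟨ cong (λ s → play G x s v) (sym (m∸n+n≡m k≤t)) ⟩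
      play G x (t ∸ k + k) v         ≡⟨ cong (λ y → y v) (play-+ x (t ∸ k) k) ⟩
      play G (play G x k) (t ∸ k) v  ≡⟨ play-allFire all (t ∸ k) v ⟩
      play G x k v                   ∎
      where open ≡-Reasoning

open Game

theorem2 : (n : ℕ) (G : Graph n) (d : ℕ) → Connected G → HasDiameter G d →
           (x : Config n) (c : ℕ) → sumFin x ≡ c → 0 < c →
           2 * twiceEdges G ≤ c + n →
           ∀ (t : ℕ) → n * d * c ≤ t → ∀ (v : Fin n) →
           play G x t v ≡ play G x (n * d * c) v
theorem2 n G d _ (diameter , _) x .(sumFin x) refl c>0 dense t T≤t v =
  let k , k≤T , all = allFire-within G x d within c>0 dense
  in trans (play-stable G x all (≤-trans k≤T T≤t) v) (sym (play-stable G x all k≤T v))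
  where
  within : DiameterAtMost G d
  within u w = let k , k≤d , walk , _ = diameter u w in k , k≤d , walk
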